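{- (Completeness) Every formula that is true at every world of every $\kappa$-model is derivable in $\mathsf{Syn}^-$.
   Context: Fix a finite set $\mathsf{Ag}$ of agents; an agent pattern is a set $G\subseteq\mathcal{P}(\mathsf{Ag})\setminus\{\emptyset\}$. Formulas: $\varphi::= p\mid\neg\varphi\mid\varphi\wedge\varphi\mid [G]\varphi$ ($p$ in a countable set $\mathsf{Prop}$, $G$ an agent pattern); $\bot:=p\wedge\neg p$ for fixed $p$; $\mathsf{alive}(G):=\neg[G]\bot$. $\mathsf{Syn}^-$ has axioms: all propositional tautologies; (K) $[G](\varphi\to\psi)\to([G]\varphi\to[G]\psi)$; (B) $\varphi\to[G]\neg[G]\neg\varphi$; (4) $[G]\varphi\to[G][G]\varphi$; (T) $\mathsf{alive}(G)\to([G]\varphi\to\varphi)$; (NE) $\bigvee_{G}\mathsf{alive}(G)$ over all agent patterns; (Mono) $[G]\varphi\to[H]\varphi$ if $G\subseteq H$; (Equiv) $[G\cup\{B\}]\varphi\to[G]\varphi$ if some $A\in G$ has $B\subseteq A$ ($B\ne\emptyset$); (Union) $\mathsf{alive}(G)\wedge\mathsf{alive}(H)\to\mathsf{alive}(G\cup H)$; (Clo) $\mathsf{alive}(G)\to\mathsf{alive}(\{A\cup B\})$ for $A,B\in G$; rules modus ponens and $[G]$-necessitation. A pre-model $\mathcal{M}=(W,\sim,V)$ consists of a set $W$, a function assigning to each agent pattern $G$ a symmetric and transitive relation $\sim_G$ on $W$, and $V:W\to\mathcal{P}(\mathsf{Prop})$. Truth: $\mathcal{M},w\Vdash p$ iff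 $p\in V(w)$; Boolean clauses as usual; $\mathcal{M},w\Vdash[G]\varphi$ iff $\mathcal{M},v\Vdash\varphi$ for all $v$ with $w\sim_G v$. $\mathsf{alive}(G)_\mathcal{M}=\{w\mid w\sim_G w\}$. A $\kappa$-model is a pre-model such that for all agent patterns $G,H$: (K1) $\mathsf{alive}(G)_\mathcal{M}\cap\mathsf{alive}(H)_\mathcal{M}\subseteq\mathsf{alive}(G\cup H)_\mathcal{M}$; (K2) $\mathsf{alive}(G)_\mathcal{M}\subseteq\mathsf{alive}(\{A\cup B\})_\mathcal{M}$ for $A,B\in G$; (K3) $\sim_H\subseteq\sim_G$ if $G\subseteq H$; (K4) $\sim_G\subseteq\sim_{G\cup\{B\}}$ if some $A\in G$ has $\emptyset\ne B\subseteq A$; (NE) every $w\in W$ has an agent pattern $G$ with $w\sim_G w$. -}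

module Defs where

open import Level using (Level; 0ℓ)
open import Data.Nat using (ℕ)
open import Data.Bool using (Bool; true; false; T; _∧_; _∨_; not)
open import Data.Unit using (⊤; tt)
open import Data.Empty using () renaming (⊥ to Empty)
open import Data.Product using (_×_; _,_; Σ; ∃)
open import Data.Sum using (_⊎_)
open import Data.Vec using ([]; _∷_)
open import Data.List using (List; []; _∷_; cartesianProduct; foldr)
open import Data.Fin.Subset using (Subset; Nonempty) renaming (_⊆_ to _⊆ˢ_; _∪_ to _∪ˢ_)
open import Relation.Binary.PropositionalEquality using (_≡_)
open import Relation.Binary using (Rel; Symmetric; Transitive)
open import Relation.Nullary using (¬_)

-- An agent pattern is a set of NONEMPTY subsets of Fin n.  We use a
-- canonical finite encoding (each set has exactly one code):
--   PSet n : arbitrary sets of subsets of Fin n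
--   Pattern n : sets of nonempty subsets of Fin n
-- split on whether agent 0 belongs to the subset.

PSet : ℕ → Set
PSet ℕ.zero    = Bool
PSet (ℕ.suc n) = PSet n × PSet n   -- (subsets without agent 0 , subsets with agent 0)

Pattern : ℕ → Set
Pattern ℕ.zero    = ⊤              -- only ∅ ⊆ Fin 0 exists, and it is excluded
Pattern (ℕ.suc n) = Pattern n × PSet n

_∈ᴾˢ_ : ∀ {n} → Subset n → PSet n → Set
_∈ᴾˢ_ {ℕ.zero}  []          b         = T b
_∈ᴾˢ_ {ℕ.suc n} (false ∷ A) (g₀ , g₁) = A ∈ᴾˢ g₀
_∈ᴾˢ_ {ℕ.suc n} (true  ∷ A) (g₀ , g₁) = A ∈ᴾˢ g₁

_∈ᴾ_ : ∀ {n} → Subset n → Pattern n → Set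
_∈ᴾ_ {ℕ.zero}  []          tt        = Empty
_∈ᴾ_ {ℕ.suc n} (false ∷ A) (g₀ , g₁) = A ∈ᴾ g₀
_∈ᴾ_ {ℕ.suc n} (true  ∷ A) (g₀ , g₁) = A ∈ᴾˢ g₁

_⊆ᴾ_ : ∀ {n} → Pattern n → Pattern n → Set
G ⊆ᴾ H = ∀ A → A ∈ᴾ G → A ∈ᴾ H

_∪ᴾˢ_ : ∀ {n} → PSet n → PSet n → PSet n
_∪ᴾˢ_ {ℕ.zero}  a b = a ∨ b
_∪ᴾˢ_ {ℕ.suc n} (a₀ , a₁) (b₀ , b₁) = (a₀ ∪ᴾˢ b₀) , (a₁ ∪ᴾˢ b₁)

_∪ᴾ_ : ∀ {n} → Pattern n → Pattern n → Pattern n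
_∪ᴾ_ {ℕ.zero}  tt tt = tt
_∪ᴾ_ {ℕ.suc n} (a₀ , a₁) (b₀ , b₁) = (a₀ ∪ᴾ b₀) , (a₁ ∪ᴾˢ b₁)

emptyᴾˢ : ∀ {n} → PSet n
emptyᴾˢ {ℕ.zero}  = false
emptyᴾˢ {ℕ.suc n} = emptyᴾˢ , emptyᴾˢ

-- singletons: singleᴾ B = {B} \ {∅}; it is only ever applied to nonempty B,
-- where it is exactly the pattern {B}.
singleᴾˢ : ∀ {n} → Subset n → PSet n
singleᴾˢ {ℕ.zero}  []          = true
singleᴾˢ {ℕ.suc n} (false ∷ B) = singleᴾˢ B , emptyᴾˢ
singleᴾˢ {ℕ.suc n} (true  ∷ B) = emptyᴾˢ , singleᴾˢ B

emptyᴾ : ∀ {n} → Pattern n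
emptyᴾ {ℕ.zero}  = tt
emptyᴾ {ℕ.suc n} = emptyᴾ , emptyᴾˢ

singleᴾ : ∀ {n} → Subset n → Pattern n
singleᴾ {ℕ.zero}  []          = tt
singleᴾ {ℕ.suc n} (false ∷ B) = singleᴾ B , emptyᴾˢ
singleᴾ {ℕ.suc n} (true  ∷ B) = emptyᴾ , singleᴾˢ B

allPSets : ∀ n → List (PSet n)
allPSets ℕ.zero    = false ∷ true ∷ []
allPSets (ℕ.suc n) = cartesianProduct (allPSets n) (allPSets n)

allPatterns : ∀ n → List (Pattern n)
allPatterns ℕ.zero    = tt ∷ []
allPatterns (ℕ.suc n) = cartesianProduct (allPatterns n) (allPSets n)

infixr 6 _∧'_
infix 8 ¬'_
infix 7 [_]_
infixr 4 _⇒_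
infixr 5 _∨'_

data Form (n : ℕ) : Set where
  var  : ℕ → Form n
  ¬'_  : Form n → Form n
  _∧'_ : Form n → Form n → Form n
  [_]_ : Pattern n → Form n → Form n

⊥' : ∀ {n} → Form n
⊥' = var 0 ∧' ¬' var 0

_⇒_ : ∀ {n} → Form n → Form n → Form n
φ ⇒ ψ = ¬' (φ ∧' ¬' ψ)

_∨'_ : ∀ {n} → Form n → Form n → Form n
φ ∨' ψ = ¬' (¬' φ ∧' ¬' ψ)

alive : ∀ {n} → Pattern n → Form n
alive G = ¬' ([ G ] ⊥')

⋁ : ∀ {n} → List (Form n) → Form n
⋁ = foldr _∨'_ ⊥'

mapL : ∀ {A B : Set} → (A → B) → List A → List B
mapL f []       = []
mapL f (x ∷ xs) = f x ∷ mapL f xs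

evalB : ∀ {n} → (ℕ → Bool) → (Pattern n → Form n → Bool) → Form n → Bool
evalB v b (var p)    = v p
evalB v b (¬' φ)     = not (evalB v b φ)
evalB v b (φ ∧' ψ)   = evalB v b φ ∧ evalB v b ψ
evalB v b ([ G ] φ)  = b G φ

Tautology : ∀ {n} → Form n → Set
Tautology φ = ∀ v b → evalB v b φ ≡ true

data ⊢_ {n : ℕ} : Form n → Set where
  taut  : ∀ {φ} → Tautology φ → ⊢ φ
  axK   : ∀ G φ ψ → ⊢ (([ G ] (φ ⇒ ψ)) ⇒ (([ G ] φ) ⇒ ([ G ] ψ)))
  axB   : ∀ G φ → ⊢ (φ ⇒ [ G ] (¬' ([ G ] (¬' φ))))
  ax4   : ∀ G φ → ⊢ (([ G ] φ) ⇒ [ G ] ([ G ] φ))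
  axT   : ∀ G φ → ⊢ (alive G ⇒ (([ G ] φ) ⇒ φ))
  axNE  : ⊢ ⋁ (mapL alive (allPatterns n))
  mono  : ∀ G H φ → G ⊆ᴾ H → ⊢ (([ G ] φ) ⇒ ([ H ] φ))
  equiv : ∀ G A B φ → A ∈ᴾ G → B ⊆ˢ A → Nonempty B →
          ⊢ (([ G ∪ᴾ singleᴾ B ] φ) ⇒ ([ G ] φ))
  union : ∀ G H → ⊢ ((alive G ∧' alive H) ⇒ alive (G ∪ᴾ H))
  clo   : ∀ G A B → A ∈ᴾ G → B ∈ᴾ G → ⊢ (alive G ⇒ alive (singleᴾ (A ∪ˢ B)))
  mp    : ∀ {φ ψ} → ⊢ (φ ⇒ ψ) → ⊢ φ → ⊢ ψ
  nec   : ∀ G {φ} → ⊢ φ → ⊢ ([ G ] φ)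

record PreModel (n : ℕ) : Set₁ where
  field
    W     : Set
    _∼[_]_ : W → Pattern n → W → Set
    sym∼   : ∀ G {w v} → w ∼[ G ] v → v ∼[ G ] w
    trans∼ : ∀ G {w v u} → w ∼[ G ] v → v ∼[ G ] u → w ∼[ G ] u
    V     : W → ℕ → Bool

  Alive : Pattern n → W → Set
  Alive G w = w ∼[ G ] w

open PreModel public

infix 2 _∣_⊩_
_∣_⊩_ : ∀ {n} (M : PreModel n) → W M → Form n → Set
M ∣ w ⊩ var p    = T (V M w p)
M ∣ w ⊩ ¬' φ     = ¬ (M ∣ w ⊩ φ)
M ∣ w ⊩ (φ ∧' ψ) = (M ∣ w ⊩ φ) × (M ∣ w ⊩ ψ)
M ∣ w ⊩ [ G ] φ  = ∀ v → _∼[_]_ M w G v → M ∣ v ⊩ φ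

record IsκModel {n : ℕ} (M : PreModel n) : Set where
  field
    K1 : ∀ G H w → Alive M G w → Alive M H w → Alive M (G ∪ᴾ H) w
    K2 : ∀ G A B → A ∈ᴾ G → B ∈ᴾ G → ∀ w → Alive M G w → Alive M (singleᴾ (A ∪ˢ B)) w
    K3 : ∀ G H → G ⊆ᴾ H → ∀ w v → _∼[_]_ M w H v → _∼[_]_ M w G v
    K4 : ∀ G A B → A ∈ᴾ G → B ⊆ˢ A → Nonempty B →
         ∀ w v → _∼[_]_ M w G v → _∼[_]_ M w (G ∪ᴾ singleᴾ B) v
    NE : ∀ w → ∃ λ G → Alive M G w

κ-valid : ∀ {n} → Form n → Set₁
κ-valid {n} φ = ∀ (M : PreModel n) → IsκModel M → ∀ w → M ∣ w ⊩ φ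

{-# OPTIONS --safe #-}

-- Let Φ consist of the subformulas of φ and all [G]⊥. An atom is a Boolean valuation a of Φ,
-- with characteristic formula cf a; ⊢ ψ holds as soon as ⊢ cf a ⇒ ψ for every atom a. Atoms are
-- G-related when they agree on every [K]χ ∈ Φ with K ≼ G (each member of K lies inside a member
-- of G) and both make χ true whenever [K]χ is true; if they are not, B, 4, T, Mono and Equiv
-- prove cf a ⇒ [G]¬cf b. Starting from all atoms we discard, one at a time, atoms a with ⊢ ¬cf a:
-- those that are propositionally incoherent or violate T, Union, Clo or NE locally, and those
-- with a false [G]χ but no remaining G-related atom falsifying χ. The survivors form a κ-model
-- satisfying the truth lemma, so a valid φ is true at each of them, while the discarded atoms
-- are refuted; hence ⊢ cf a ⇒ φ for every atom, and ⊢ φ.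

module Submission where

open import Data.Nat using (ℕ; zero; suc; _<_)
import Data.Nat as ℕ
open import Data.Fin using (zero; suc)
open import Data.Fin.Subset using (Subset; Nonempty) renaming (_⊆_ to _⊆ˢ_; _∪_ to _∪ˢ_)
open import Data.Fin.Subset.Properties using (_⊆?_)
open import Data.Nat.Induction using (<-wellFounded)
open import Data.Nat.Properties using (≤-reflexive)
open import Data.Bool using (Bool; true; false; _∧_; not)
import Data.Bool as Bool
open import Data.Bool.Properties using (∧-conicalˡ; ∧-conicalʳ; ∧-inverseʳ; T?; T-∨; not-injective; ¬-not)
open import Data.Product using (∃; _×_; _,_; proj₁; proj₂)
import Data.Product as Product
import Data.Product.Properties as ×
open import Data.Sum as Sum using (_⊎_; inj₁; inj₂; [_,_]′)
import Data.Sum.Effectful.Right as Sumᵣ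
open import Effect.Applicative using (RawApplicative)
open import Level using (0ℓ)
open import Data.Unit using (⊤; tt)
import Data.Unit.Properties as Unit
open import Data.Vec using (Vec; []; _∷_; here; there)
open import Data.List using (List; []; _∷_; _++_; length; map; cartesianProductWith; filter; concatMap)
open import Data.List.Properties using (length-removeAt′)
open import Data.List.Relation.Unary.All as All using (All; []; _∷_)
open import Data.List.Relation.Unary.All.Properties using (all-filter)
open import Data.List.Relation.Unary.Any as Any using (Any; here; there; _─_)
open import Data.List.Membership.Propositional using (_∈_; lose; find)
open import Data.List.Membership.Propositional.Properties using (∈-cartesianProductWith⁺; ∈-cartesianProduct⁺; ∈-filter⁺; ∈-++⁺ˡ; ∈-++⁺ʳ; ∈-++⁻; ∈-concatMap⁺; ∈-concatMap⁻; ∈-map⁺)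
open import Function using (_∘_; id; const; _⇔_; mk⇔; Equivalence)
open import Induction.WellFounded using (Acc; acc)
open import Relation.Binary.Definitions using (DecidableEquality)
open import Relation.Binary.PropositionalEquality using (_≡_; _≢_; refl; sym; trans; cong; cong₂; subst; module ≡-Reasoning)
open import Relation.Nullary using (Dec; yes; no; ¬_; contradiction)
open import Relation.Nullary.Reflects using (Reflects; ofʸ; ofⁿ; T-reflects; ¬-reflects; _×-reflects_)
import Relation.Nullary.Decidable as Dec
open import Relation.Nullary.Decidable using (_×-dec_; _→-dec_)
open import Relation.Unary using (Decidable)
open import Defs

-- Truth tables and reflection

BoolFun : ℕ → Set
BoolFun zero    = Bool
BoolFun (suc k) = Bool → BoolFun k

allRows : ∀ k → BoolFun k → Bool
allRows zero    b = b
allRows (suc k) f = allRows k (f false) ∧ allRows k (f true)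

Valid : ∀ k → BoolFun k → Set
Valid zero    b = b ≡ true
Valid (suc k) f = ∀ x → Valid k (f x)

byTruthTable : ∀ k (f : BoolFun k) → allRows k f ≡ true → Valid k f
byTruthTable zero    b h       = h
byTruthTable (suc k) f h false = byTruthTable k (f false) (∧-conicalˡ _ _ h)
byTruthTable (suc k) f h true  = byTruthTable k (f true) (∧-conicalʳ _ _ h)

infixr 4 _⇒ᵇ_
_⇒ᵇ_ : Bool → Bool → Bool
x ⇒ᵇ y = not (x ∧ not y)

⇒ᵇ-intro : ∀ {x y} → (x ≡ true → y ≡ true) → (x ⇒ᵇ y) ≡ true
⇒ᵇ-intro {false} h = refl
⇒ᵇ-intro {true}  h rewrite h refl = refl

not-≢-true : ∀ {x} → x ≢ true → not x ≡ true
not-≢-true {false} _ = refl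
not-≢-true {true}  h = contradiction refl h

reflects⇒ : ∀ {P : Set} {b} → Reflects P b → b ≡ true → P
reflects⇒ (ofʸ p) _ = p

reflects¬ : ∀ {P : Set} {b} → Reflects P b → b ≡ false → ¬ P
reflects¬ (ofⁿ ¬p) _ = ¬p

reflects⇐ : ∀ {P : Set} {b} → Reflects P b → P → b ≡ true
reflects⇐ (ofʸ _)  _ = refl
reflects⇐ (ofⁿ ¬p) p = contradiction p ¬p

-- Derived rules of Syn⁻

module _ {n : ℕ} where

  private
    variable
      φ ψ χ X : Form n
      G K : Pattern n

  ⊤' : Form n
  ⊤' = ¬' ⊥'

  ⊤-intro : ⊢ ⊤'
  ⊤-intro = taut λ v b → byTruthTable 1 (λ p → not (p ∧ not p)) refl (v 0)

  ⇒-refl : ⊢ (φ ⇒ φ)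
  ⇒-refl {φ} = taut λ v b → byTruthTable 1 (λ x → x ⇒ᵇ x) refl (evalB v b φ)

  ⇒-trans : ⊢ (φ ⇒ ψ) → ⊢ (ψ ⇒ χ) → ⊢ (φ ⇒ χ)
  ⇒-trans {φ} {ψ} {χ} p q = mp (mp (taut λ v b →
    byTruthTable 3 (λ x y z → (x ⇒ᵇ y) ⇒ᵇ (y ⇒ᵇ z) ⇒ᵇ x ⇒ᵇ z) refl
      (evalB v b φ) (evalB v b ψ) (evalB v b χ)) p) q

  ⇒-const : ⊢ ψ → ⊢ (φ ⇒ ψ)
  ⇒-const {ψ} {φ} = mp (taut λ v b →
    byTruthTable 2 (λ y x → y ⇒ᵇ x ⇒ᵇ y) refl (evalB v b ψ) (evalB v b φ))

  ⇒-∧ : ⊢ (X ⇒ φ) → ⊢ (X ⇒ ψ) → ⊢ (X ⇒ φ ∧' ψ)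
  ⇒-∧ {X} {φ} {ψ} p q = mp (mp (taut λ v b →
    byTruthTable 3 (λ x y z → (x ⇒ᵇ y) ⇒ᵇ (x ⇒ᵇ z) ⇒ᵇ x ⇒ᵇ y ∧ z) refl
      (evalB v b X) (evalB v b φ) (evalB v b ψ)) p) q

  ⇒-mp : ⊢ (X ⇒ φ) → ⊢ (X ⇒ φ ⇒ ψ) → ⊢ (X ⇒ ψ)
  ⇒-mp {X} {φ} {ψ} p q = mp (mp (taut λ v b →
    byTruthTable 3 (λ x y z → (x ⇒ᵇ y) ⇒ᵇ (x ⇒ᵇ y ⇒ᵇ z) ⇒ᵇ x ⇒ᵇ z) refl
      (evalB v b X) (evalB v b φ) (evalB v b ψ)) p) q

  ⇒-absurd : ⊢ (X ⇒ φ) → ⊢ (X ⇒ ¬' φ) → ⊢ (¬' X)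
  ⇒-absurd {X} {φ} p q = mp (mp (taut λ v b →
    byTruthTable 2 (λ x y → (x ⇒ᵇ y) ⇒ᵇ (x ⇒ᵇ not y) ⇒ᵇ not x) refl
      (evalB v b X) (evalB v b φ)) p) q

  explosion : ⊢ (¬' φ ⇒ φ ⇒ ψ)
  explosion {φ} {ψ} = taut λ v b →
    byTruthTable 2 (λ x y → not x ⇒ᵇ x ⇒ᵇ y) refl (evalB v b φ) (evalB v b ψ)

  ¬-⇒ : ⊢ (¬' φ) → ⊢ (φ ⇒ ψ)
  ¬-⇒ = mp explosion

  ¬¬-intro : ⊢ (φ ⇒ ¬' ¬' φ)
  ¬¬-intro {φ} = taut λ v b → byTruthTable 1 (λ x → x ⇒ᵇ not (not x)) refl (evalB v b φ)

  contraposition : ⊢ (φ ⇒ ψ) → ⊢ (¬' ψ ⇒ ¬' φ)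
  contraposition {φ} {ψ} = mp (taut λ v b →
    byTruthTable 2 (λ x y → (x ⇒ᵇ y) ⇒ᵇ not y ⇒ᵇ not x) refl (evalB v b φ) (evalB v b ψ))

  contraposition¬ : ⊢ (φ ⇒ ¬' ψ) → ⊢ (ψ ⇒ ¬' φ)
  contraposition¬ {φ} {ψ} = mp (taut λ v b →
    byTruthTable 2 (λ x y → (x ⇒ᵇ not y) ⇒ᵇ y ⇒ᵇ not x) refl (evalB v b φ) (evalB v b ψ))

  ⇒-¬∨ : ⊢ (X ⇒ ¬' φ) → ⊢ (X ⇒ ¬' ψ) → ⊢ (X ⇒ ¬' (φ ∨' ψ))
  ⇒-¬∨ {X} {φ} {ψ} p q = mp (mp (taut λ v b →
    byTruthTable 3 (λ x y z → (x ⇒ᵇ not y) ⇒ᵇ (x ⇒ᵇ not z) ⇒ᵇ x ⇒ᵇ not (not (not y ∧ not z))) refl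
      (evalB v b X) (evalB v b φ) (evalB v b ψ)) p) q

  □-mono : ∀ G → ⊢ (φ ⇒ ψ) → ⊢ ([ G ] φ ⇒ [ G ] ψ)
  □-mono {φ} {ψ} G p = mp (axK G φ ψ) (nec G p)

  □-∧ : ∀ G → ⊢ (X ⇒ [ G ] φ) → ⊢ (X ⇒ [ G ] ψ) → ⊢ (X ⇒ [ G ] (φ ∧' ψ))
  □-∧ {X} {φ} {ψ} G p q = ⇒-mp q (⇒-trans p (⇒-trans (□-mono G pair) (axK G ψ (φ ∧' ψ))))
    where
    pair : ⊢ (φ ⇒ ψ ⇒ φ ∧' ψ)
    pair = taut λ v b → byTruthTable 2 (λ x y → x ⇒ᵇ y ⇒ᵇ x ∧ y) refl (evalB v b φ) (evalB v b ψ)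

  □-T : ⊢ (X ⇒ alive G) → ⊢ (X ⇒ [ G ] φ) → ⊢ (X ⇒ φ)
  □-T {G = G} {φ} p q = ⇒-mp q (⇒-mp p (⇒-const (axT G φ)))

  □-T⊥ : ⊢ (X ⇒ [ K ] φ) → ⊢ (X ⇒ ¬' φ) → ⊢ (X ⇒ [ K ] ⊥')
  □-T⊥ {X} {K} {φ} p q = mp (mp (mp (taut λ v b →
    byTruthTable 4 (λ t d k y → (not d ⇒ᵇ k ⇒ᵇ y) ⇒ᵇ (t ⇒ᵇ k) ⇒ᵇ (t ⇒ᵇ not y) ⇒ᵇ t ⇒ᵇ d)
      refl
      (evalB v b X) (evalB v b ([ K ] ⊥')) (evalB v b ([ K ] φ)) (evalB v b φ)) (axT K φ)) p) q

  axiom5 : ∀ K φ → ⊢ (¬' ([ K ] φ) ⇒ [ K ] ¬' ([ K ] φ))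
  axiom5 K φ = ⇒-trans (axB K (¬' ([ K ] φ)))
    (□-mono K (contraposition (⇒-trans (ax4 K φ) (□-mono K ¬¬-intro))))

  ⇒-¬⋁ : ∀ {A : Set} {X : Form n} (f : A → Form n) xs →
         (∀ x → ⊢ (X ⇒ ¬' f x)) → ⊢ (X ⇒ ¬' ⋁ (mapL f xs))
  ⇒-¬⋁ f []       h = ⇒-const ⊤-intro
  ⇒-¬⋁ f (x ∷ xs) h = ⇒-¬∨ (h x) (⇒-¬⋁ f xs h)

-- Finite search

dec-→-⊎ : ∀ {P Q R : Set} → Dec P → (P → Q ⊎ R) → (P → Q) ⊎ R
dec-→-⊎ (yes p) f = Sum.map₁ const (f p)
dec-→-⊎ (no ¬p) f = inj₁ λ p → contradiction p ¬p

module _ {A : Set} where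

  private
    variable
      P : A → Set
      R : Set

  ∀∈-or : ∀ (xs : List A) → (∀ {x} → x ∈ xs → P x ⊎ R) → (∀ {x} → x ∈ xs → P x) ⊎ R
  ∀∈-or []       f = inj₁ λ ()
  ∀∈-or (x ∷ xs) f with f (here refl) | ∀∈-or xs (f ∘ there)
  ... | inj₂ r  | _        = inj₂ r
  ... | inj₁ _  | inj₂ r   = inj₂ r
  ... | inj₁ px | inj₁ pxs = inj₁ λ { (here refl) → px ; (there m) → pxs m }

  module Listed (xs : List A) (complete : ∀ x → x ∈ xs) where

    ∀-or : (∀ x → P x ⊎ R) → (∀ x → P x) ⊎ R
    ∀-or f = Sum.map (λ all x → All.lookup all (complete x)) (proj₂ ∘ Any.satisfied)
                     (All.decide f xs)

    ∀? : Decidable P → Dec (∀ x → P x)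
    ∀? P? = Dec.map′ (λ all x → All.lookup all (complete x)) (λ f → All.tabulate λ {x} _ → f x)
                     (All.all? P? xs)

    ∃? : Decidable P → Dec (∃ P)
    ∃? P? = Dec.map′ Any.satisfied (λ (x , px) → lose (complete x) px) (Any.any? P? xs)

vectors : ∀ m → List (Vec Bool m)
vectors zero    = [] ∷ []
vectors (suc m) = cartesianProductWith _∷_ (false ∷ true ∷ []) (vectors m)

vectors-complete : ∀ {m} (v : Vec Bool m) → v ∈ vectors m
vectors-complete []      = here refl
vectors-complete (x ∷ v) = ∈-cartesianProductWith⁺ _∷_ (bool∈ x) (vectors-complete v)
  where
  bool∈ : ∀ x → x ∈ false ∷ true ∷ []
  bool∈ false = here refl
  bool∈ true  = there (here refl)

allPSets-complete : ∀ {n} (g : PSet n) → g ∈ allPSets n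
allPSets-complete {zero}  false   = here refl
allPSets-complete {zero}  true    = there (here refl)
allPSets-complete {suc n} (g , h) = ∈-cartesianProduct⁺ (allPSets-complete g) (allPSets-complete h)

allPatterns-complete : ∀ {n} (G : Pattern n) → G ∈ allPatterns n
allPatterns-complete {zero}  tt      = here refl
allPatterns-complete {suc n} (G , g) = ∈-cartesianProduct⁺ (allPatterns-complete G) (allPSets-complete g)

module Subsets {n : ℕ} = Listed (vectors n) vectors-complete
module Patterns {n : ℕ} = Listed (allPatterns n) allPatterns-complete

-- Elimination

module _ {A : Set} where

  ∈-─⁻ : ∀ {P : A → Set} {xs x} (p : Any P xs) → x ∈ xs → x ∈ (xs ─ p) ⊎ P x
  ∈-─⁻ (here px) (here refl) = inj₂ px
  ∈-─⁻ (here _)  (there m)   = inj₁ m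
  ∈-─⁻ (there _) (here refl) = inj₁ (here refl)
  ∈-─⁻ (there p) (there m)   = Sum.map₁ there (∈-─⁻ p m)

  Covers : (A → Set) → List A → Set
  Covers R S = ∀ x → x ∈ S ⊎ R x

  module Elimination (Refuted : A → Set) (Ok : List A → A → Set)
           (classify : ∀ S → Covers Refuted S → ∀ x → Ok S x ⊎ Refuted x) where

    Stable : List A → Set
    Stable S = Covers Refuted S × (∀ {x} → x ∈ S → Ok S x)

    eliminate : ∀ S → Covers Refuted S → ∃ Stable
    eliminate S = go S (<-wellFounded (length S))
      where
      go : ∀ S → Acc _<_ (length S) → Covers Refuted S → ∃ Stable
      go S (acc smaller) cover with All.decide (classify S cover) S
      ... | inj₁ ok  = S , cover , All.lookup ok
      ... | inj₂ bad = go (S ─ bad) (smaller shorter) λ x → [ ∈-─⁻ bad , inj₂ ]′ (cover x)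
        where
        shorter : length (S ─ bad) < length S
        shorter = ≤-reflexive (sym (length-removeAt′ S (Any.index bad)))

-- Agent patterns

_∈ᴾˢ?_ : ∀ {n} (A : Subset n) (g : PSet n) → Dec (A ∈ᴾˢ g)
_∈ᴾˢ?_ {zero}  []          g         = T? g
_∈ᴾˢ?_ {suc n} (false ∷ A) (g₀ , g₁) = A ∈ᴾˢ? g₀
_∈ᴾˢ?_ {suc n} (true ∷ A)  (g₀ , g₁) = A ∈ᴾˢ? g₁

_∈ᴾ?_ : ∀ {n} (A : Subset n) (G : Pattern n) → Dec (A ∈ᴾ G)
_∈ᴾ?_ {zero}  []          tt        = no λ ()
_∈ᴾ?_ {suc n} (false ∷ A) (G₀ , g₁) = A ∈ᴾ? G₀
_∈ᴾ?_ {suc n} (true ∷ A)  (G₀ , g₁) = A ∈ᴾˢ? g₁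

∈ᴾˢ-∪ : ∀ {n} (A : Subset n) g h → A ∈ᴾˢ (g ∪ᴾˢ h) ⇔ (A ∈ᴾˢ g ⊎ A ∈ᴾˢ h)
∈ᴾˢ-∪ {zero}  []          g         h         = T-∨
∈ᴾˢ-∪ {suc n} (false ∷ A) (g₀ , g₁) (h₀ , h₁) = ∈ᴾˢ-∪ A g₀ h₀
∈ᴾˢ-∪ {suc n} (true ∷ A)  (g₀ , g₁) (h₀ , h₁) = ∈ᴾˢ-∪ A g₁ h₁

∈ᴾ-∪ : ∀ {n} (A : Subset n) G H → A ∈ᴾ (G ∪ᴾ H) ⇔ (A ∈ᴾ G ⊎ A ∈ᴾ H)
∈ᴾ-∪ {zero}  []          tt        tt        = mk⇔ (λ ()) λ { (inj₁ ()) ; (inj₂ ()) }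
∈ᴾ-∪ {suc n} (false ∷ A) (G₀ , g₁) (H₀ , h₁) = ∈ᴾ-∪ A G₀ H₀
∈ᴾ-∪ {suc n} (true ∷ A)  (G₀ , g₁) (H₀ , h₁) = ∈ᴾˢ-∪ A g₁ h₁

∈ᴾ-∪ˡ : ∀ {n} {A : Subset n} {G} H → A ∈ᴾ G → A ∈ᴾ (G ∪ᴾ H)
∈ᴾ-∪ˡ {A = A} {G} H = Equivalence.from (∈ᴾ-∪ A G H) ∘ inj₁

∈ᴾ-∪ʳ : ∀ {n} {A : Subset n} G {H} → A ∈ᴾ H → A ∈ᴾ (G ∪ᴾ H)
∈ᴾ-∪ʳ {A = A} G {H} = Equivalence.from (∈ᴾ-∪ A G H) ∘ inj₂

∉ᴾˢ-empty : ∀ {n} (A : Subset n) → ¬ A ∈ᴾˢ emptyᴾˢ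
∉ᴾˢ-empty {zero}  []          ()
∉ᴾˢ-empty {suc n} (false ∷ A) = ∉ᴾˢ-empty A
∉ᴾˢ-empty {suc n} (true ∷ A)  = ∉ᴾˢ-empty A

∉ᴾ-empty : ∀ {n} (A : Subset n) → ¬ A ∈ᴾ emptyᴾ
∉ᴾ-empty {zero}  []          ()
∉ᴾ-empty {suc n} (false ∷ A) = ∉ᴾ-empty A
∉ᴾ-empty {suc n} (true ∷ A)  = ∉ᴾˢ-empty A

∈ᴾˢ-single⁺ : ∀ {n} (A : Subset n) → A ∈ᴾˢ singleᴾˢ A
∈ᴾˢ-single⁺ {zero}  []          = tt
∈ᴾˢ-single⁺ {suc n} (false ∷ A) = ∈ᴾˢ-single⁺ A
∈ᴾˢ-single⁺ {suc n} (true ∷ A)  = ∈ᴾˢ-single⁺ A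

∈ᴾˢ-single⁻ : ∀ {n} (A B : Subset n) → A ∈ᴾˢ singleᴾˢ B → A ≡ B
∈ᴾˢ-single⁻ {zero}  []          []          _ = refl
∈ᴾˢ-single⁻ {suc n} (false ∷ A) (false ∷ B) p = cong (false ∷_) (∈ᴾˢ-single⁻ A B p)
∈ᴾˢ-single⁻ {suc n} (true ∷ A)  (true ∷ B)  p = cong (true ∷_) (∈ᴾˢ-single⁻ A B p)
∈ᴾˢ-single⁻ {suc n} (false ∷ A) (true ∷ B)  p = contradiction p (∉ᴾˢ-empty A)
∈ᴾˢ-single⁻ {suc n} (true ∷ A)  (false ∷ B) p = contradiction p (∉ᴾˢ-empty A)

∈ᴾ-single⁺ : ∀ {n} (A : Subset n) → Nonempty A → A ∈ᴾ singleᴾ A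
∈ᴾ-single⁺ {suc n} (true ∷ A)  _                = ∈ᴾˢ-single⁺ A
∈ᴾ-single⁺ {suc n} (false ∷ A) (suc i , there p) = ∈ᴾ-single⁺ A (i , p)

∈ᴾ-single⁻ : ∀ {n} (A B : Subset n) → A ∈ᴾ singleᴾ B → A ≡ B
∈ᴾ-single⁻ {suc n} (false ∷ A) (false ∷ B) p = cong (false ∷_) (∈ᴾ-single⁻ A B p)
∈ᴾ-single⁻ {suc n} (true ∷ A)  (true ∷ B)  p = cong (true ∷_) (∈ᴾˢ-single⁻ A B p)
∈ᴾ-single⁻ {suc n} (false ∷ A) (true ∷ B)  p = contradiction p (∉ᴾ-empty A)
∈ᴾ-single⁻ {suc n} (true ∷ A)  (false ∷ B) p = contradiction p (∉ᴾˢ-empty A)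

∈ᴾ⇒nonempty : ∀ {n} (A : Subset n) G → A ∈ᴾ G → Nonempty A
∈ᴾ⇒nonempty {suc n} (true ∷ A)  _         _ = zero , here
∈ᴾ⇒nonempty {suc n} (false ∷ A) (G₀ , _)  p with i , q ← ∈ᴾ⇒nonempty A G₀ p = suc i , there q

infix 4 _≼_
_≼_ : ∀ {n} → Pattern n → Pattern n → Set
K ≼ G = ∀ A → A ∈ᴾ K → ∃ λ B → B ∈ᴾ G × A ⊆ˢ B

_≼?_ : ∀ {n} (K G : Pattern n) → Dec (K ≼ G)
K ≼? G = Subsets.∀? λ A → A ∈ᴾ? K →-dec Subsets.∃? λ B → B ∈ᴾ? G ×-dec A ⊆? B

≼-refl : ∀ {n} {G : Pattern n} → G ≼ G
≼-refl A p = A , p , id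

≼-trans : ∀ {n} {K G H : Pattern n} → K ≼ G → G ≼ H → K ≼ H
≼-trans K≼G G≼H A p with B , q , A⊆B ← K≼G A p with C , r , B⊆C ← G≼H B q = C , r , B⊆C ∘ A⊆B

⊆ᴾ⇒≼ : ∀ {n} {G H : Pattern n} → G ⊆ᴾ H → G ≼ H
⊆ᴾ⇒≼ G⊆H A p = A , G⊆H A p , id

∪-single-≼ : ∀ {n} {G : Pattern n} {A B} → A ∈ᴾ G → B ⊆ˢ A → G ∪ᴾ singleᴾ B ≼ G
∪-single-≼ {G = G} {A} {B} A∈G B⊆A C p with Equivalence.to (∈ᴾ-∪ C G (singleᴾ B)) p
... | inj₁ C∈G = C , C∈G , id
... | inj₂ C∈B with refl ← ∈ᴾ-single⁻ C B C∈B = A , A∈G , B⊆A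

_∪ᴾ⋆_ : ∀ {n} → Pattern n → List (Subset n) → Pattern n
G ∪ᴾ⋆ []      = G
G ∪ᴾ⋆ (A ∷ L) = (G ∪ᴾ⋆ L) ∪ᴾ singleᴾ A

∈-∪ᴾ⋆ˡ : ∀ {n} (G : Pattern n) L {A} → A ∈ᴾ G → A ∈ᴾ (G ∪ᴾ⋆ L)
∈-∪ᴾ⋆ˡ G []      p = p
∈-∪ᴾ⋆ˡ G (B ∷ L) p = ∈ᴾ-∪ˡ (singleᴾ B) (∈-∪ᴾ⋆ˡ G L p)

∈-∪ᴾ⋆ʳ : ∀ {n} (G : Pattern n) {L A} → A ∈ L → Nonempty A → A ∈ᴾ (G ∪ᴾ⋆ L)
∈-∪ᴾ⋆ʳ G {A ∷ L} {A} (here refl) ne = ∈ᴾ-∪ʳ (G ∪ᴾ⋆ L) (∈ᴾ-single⁺ A ne)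
∈-∪ᴾ⋆ʳ G {B ∷ L}     (there m)   ne = ∈ᴾ-∪ˡ (singleᴾ B) (∈-∪ᴾ⋆ʳ G m ne)

module _ {n : ℕ} where

  □-∪ᴾ⋆ : ∀ (K G : Pattern n) → K ≼ G → ∀ L → All (_∈ᴾ K) L →
          ∀ φ → ⊢ ([ G ∪ᴾ⋆ L ] φ ⇒ [ G ] φ)
  □-∪ᴾ⋆ K G K≼G []      []           φ = ⇒-refl
  □-∪ᴾ⋆ K G K≼G (A ∷ L) (A∈K ∷ L⊆K) φ with B , B∈G , A⊆B ← K≼G A A∈K =
    ⇒-trans (equiv (G ∪ᴾ⋆ L) B A φ (∈-∪ᴾ⋆ˡ G L B∈G) A⊆B (∈ᴾ⇒nonempty A K A∈K))
            (□-∪ᴾ⋆ K G K≼G L L⊆K φ)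

  □-refine : ∀ {K G : Pattern n} → K ≼ G → ∀ φ → ⊢ ([ K ] φ ⇒ [ G ] φ)
  □-refine {K} {G} K≼G φ =
    ⇒-trans (mono K (G ∪ᴾ⋆ members) φ K⊆)
            (□-∪ᴾ⋆ K G K≼G members (all-filter (_∈ᴾ? K) (vectors n)) φ)
    where
    members : List (Subset n)
    members = filter (_∈ᴾ? K) (vectors n)
    K⊆ : K ⊆ᴾ (G ∪ᴾ⋆ members)
    K⊆ A A∈K = ∈-∪ᴾ⋆ʳ G (∈-filter⁺ (_∈ᴾ? K) (vectors-complete A) A∈K) (∈ᴾ⇒nonempty A K A∈K)

-- Formulas

_≟ᴾˢ_ : ∀ {n} → DecidableEquality (PSet n)
_≟ᴾˢ_ {zero}  = Bool._≟_
_≟ᴾˢ_ {suc n} = ×.≡-dec _≟ᴾˢ_ _≟ᴾˢ_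

_≟ᴾ_ : ∀ {n} → DecidableEquality (Pattern n)
_≟ᴾ_ {zero}  = Unit._≟_
_≟ᴾ_ {suc n} = ×.≡-dec _≟ᴾ_ _≟ᴾˢ_

module _ {n : ℕ} where

  _≟_ : DecidableEquality (Form n)
  var p ≟ var q = Dec.map′ (cong var) (λ { refl → refl }) (p ℕ.≟ q)
  (¬' φ) ≟ (¬' ψ) = Dec.map′ (cong ¬'_) (λ { refl → refl }) (φ ≟ ψ)
  (φ₁ ∧' φ₂) ≟ (ψ₁ ∧' ψ₂) =
    Dec.map′ (λ (p , q) → cong₂ _∧'_ p q) (λ { refl → refl , refl }) (φ₁ ≟ ψ₁ ×-dec φ₂ ≟ ψ₂)
  ([ G ] φ) ≟ ([ H ] ψ) =
    Dec.map′ (λ (p , q) → cong₂ [_]_ p q) (λ { refl → refl , refl }) (G ≟ᴾ H ×-dec φ ≟ ψ)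
  var _     ≟ (¬' _)    = no λ ()
  var _     ≟ (_ ∧' _)  = no λ ()
  var _     ≟ ([ _ ] _) = no λ ()
  (¬' _)    ≟ var _     = no λ ()
  (¬' _)    ≟ (_ ∧' _)  = no λ ()
  (¬' _)    ≟ ([ _ ] _) = no λ ()
  (_ ∧' _)  ≟ var _     = no λ ()
  (_ ∧' _)  ≟ (¬' _)    = no λ ()
  (_ ∧' _)  ≟ ([ _ ] _) = no λ ()
  ([ _ ] _) ≟ var _     = no λ ()
  ([ _ ] _) ≟ (¬' _)    = no λ ()
  ([ _ ] _) ≟ (_ ∧' _)  = no λ ()

  infix 4 _≺_
  data _≺_ : Form n → Form n → Set where
    ≺¬  : ∀ {φ} → φ ≺ ¬' φ
    ≺∧ˡ : ∀ {φ ψ} → φ ≺ φ ∧' ψ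
    ≺∧ʳ : ∀ {φ ψ} → ψ ≺ φ ∧' ψ
    ≺□  : ∀ {G φ} → φ ≺ [ G ] φ

  SubformulaClosed : List (Form n) → Set
  SubformulaClosed Φ = ∀ {φ ψ} → ψ ∈ Φ → φ ≺ ψ → φ ∈ Φ

  subformulas : Form n → List (Form n)
  subformulas (var p)   = var p ∷ []
  subformulas (¬' φ)    = ¬' φ ∷ subformulas φ
  subformulas (φ ∧' ψ)  = φ ∧' ψ ∷ subformulas φ ++ subformulas ψ
  subformulas ([ G ] φ) = [ G ] φ ∷ subformulas φ

  ∈-subformulas : ∀ φ → φ ∈ subformulas φ
  ∈-subformulas (var p)   = here refl
  ∈-subformulas (¬' φ)    = here refl
  ∈-subformulas (φ ∧' ψ)  = here refl
  ∈-subformulas ([ G ] φ) = here refl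

  subformulas-closed : ∀ θ → SubformulaClosed (subformulas θ)
  subformulas-closed (var p)   (here refl) ()
  subformulas-closed (¬' φ)    (here refl) ≺¬  = there (∈-subformulas φ)
  subformulas-closed (φ ∧' ψ)  (here refl) ≺∧ˡ = there (∈-++⁺ˡ (∈-subformulas φ))
  subformulas-closed (φ ∧' ψ)  (here refl) ≺∧ʳ = there (∈-++⁺ʳ (subformulas φ) (∈-subformulas ψ))
  subformulas-closed ([ G ] φ) (here refl) ≺□  = there (∈-subformulas φ)
  subformulas-closed (¬' φ)    (there m) s = there (subformulas-closed φ m s)
  subformulas-closed ([ G ] φ) (there m) s = there (subformulas-closed φ m s)
  subformulas-closed (φ ∧' ψ)  (there m) s with ∈-++⁻ (subformulas φ) m
  ... | inj₁ m′ = there (∈-++⁺ˡ (subformulas-closed φ m′ s))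
  ... | inj₂ m′ = there (∈-++⁺ʳ (subformulas φ) (subformulas-closed ψ m′ s))

  subformulas⋆ : List (Form n) → List (Form n)
  subformulas⋆ = concatMap subformulas

  ⊆-subformulas⋆ : ∀ Γ {φ} → φ ∈ Γ → φ ∈ subformulas⋆ Γ
  ⊆-subformulas⋆ Γ {φ} m = ∈-concatMap⁺ subformulas (Any.map (λ { refl → ∈-subformulas φ }) m)

  subformulas⋆-closed : ∀ Γ → SubformulaClosed (subformulas⋆ Γ)
  subformulas⋆-closed Γ m s =
    ∈-concatMap⁺ subformulas
      (Any.map (λ {θ} m′ → subformulas-closed θ m′ s) (∈-concatMap⁻ subformulas {xs = Γ} m))

  OnBoxes : (Pattern n → Form n → Set) → Form n → Set
  OnBoxes P ([ K ] χ) = P K χ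
  OnBoxes P _         = ⊤

  ∀□∈-or : ∀ {P : Pattern n → Form n → Set} {R : Set} Φ →
           (∀ {K χ} → [ K ] χ ∈ Φ → P K χ ⊎ R) → (∀ {K χ} → [ K ] χ ∈ Φ → P K χ) ⊎ R
  ∀□∈-or {P} {R} Φ f = Sum.map₁ (λ h m → h m) (∀∈-or Φ at)
    where
    at : ∀ {ψ} → ψ ∈ Φ → OnBoxes P ψ ⊎ R
    at {var _}   _ = inj₁ tt
    at {¬' _}    _ = inj₁ tt
    at {_ ∧' _}  _ = inj₁ tt
    at {[ _ ] _} m = f m

-- Characteristic formulas

module _ {n : ℕ} where

  valueIn : (Φ : List (Form n)) → Vec Bool (length Φ) → Form n → Bool
  valueIn []      []      ψ = false
  valueIn (θ ∷ Φ) (x ∷ a) ψ with ψ ≟ θ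
  ... | yes _ = x
  ... | no  _ = valueIn Φ a ψ

  literal : Form n → Bool → Form n
  literal ψ true  = ψ
  literal ψ false = ¬' ψ

  characteristic : (Φ : List (Form n)) → Vec Bool (length Φ) → Form n
  characteristic []      []      = ⊤'
  characteristic (θ ∷ Φ) (x ∷ a) = literal θ x ∧' characteristic Φ a

  module _ (v : ℕ → Bool) (b : Pattern n → Form n → Bool) where

    literal-eval⁻ : ∀ ψ x → evalB v b (literal ψ x) ≡ true → evalB v b ψ ≡ x
    literal-eval⁻ ψ true  h = h
    literal-eval⁻ ψ false h = not-injective {y = false} h

    literal-eval⁺ : ∀ ψ x → evalB v b ψ ≡ x → evalB v b (literal ψ x) ≡ true
    literal-eval⁺ ψ true  h = h
    literal-eval⁺ ψ false h = cong not h

    characteristic-eval : ∀ Φ a → evalB v b (characteristic Φ a) ≡ true →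
                          ∀ {ψ} → ψ ∈ Φ → evalB v b ψ ≡ valueIn Φ a ψ
    characteristic-eval (θ ∷ Φ) (x ∷ a) h {ψ} m with ψ ≟ θ | m
    ... | yes refl | _         = literal-eval⁻ θ x (∧-conicalˡ _ _ h)
    ... | no ψ≢θ   | here ψ≡θ  = contradiction ψ≡θ ψ≢θ
    ... | no _     | there m′  = characteristic-eval Φ a (∧-conicalʳ _ _ h) m′

  characteristic⇒literal : ∀ Φ a {ψ} → ψ ∈ Φ → ⊢ (characteristic Φ a ⇒ literal ψ (valueIn Φ a ψ))
  characteristic⇒literal Φ a {ψ} m = taut λ v b → ⇒ᵇ-intro λ h →
    literal-eval⁺ v b ψ (valueIn Φ a ψ) (characteristic-eval v b Φ a h m)

  refute-by-eval : ∀ Φ a → (∀ v b → evalB v b (characteristic Φ a) ≢ true) → ⊢ (¬' characteristic Φ a)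
  refute-by-eval Φ a h = taut λ v b → not-≢-true (h v b)

  module Exhaustion (Holds : Form n → Set)
                    (holds-∧ : ∀ {φ ψ} → Holds φ → Holds ψ → Holds (φ ∧' ψ))
                    (holds-⇒ : ∀ {φ ψ} → ⊢ (φ ⇒ ψ) → Holds φ → Holds ψ) where

    by-characteristic : ∀ Φ {χ} → (∀ a → Holds (characteristic Φ a ⇒ χ)) → Holds χ
    by-characteristic [] {χ} h = holds-⇒ ⊤⇒-elim (h [])
      where
      ⊤⇒-elim : ⊢ ((⊤' ⇒ χ) ⇒ χ)
      ⊤⇒-elim = taut λ v b → byTruthTable 2 (λ p c → (not (p ∧ not p) ⇒ᵇ c) ⇒ᵇ c) refl
        (v 0) (evalB v b χ)
    by-characteristic (θ ∷ Φ) {χ} h = holds-⇒ byCases (holds-∧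
      (by-characteristic Φ λ a → holds-⇒ (export θ) (h (true ∷ a)))
      (by-characteristic Φ λ a → holds-⇒ (export (¬' θ)) (h (false ∷ a))))
      where
      export : ∀ ℓ {γ} → ⊢ ((ℓ ∧' γ ⇒ χ) ⇒ γ ⇒ ℓ ⇒ χ)
      export ℓ {γ} = taut λ v b → byTruthTable 3 (λ l g c → (l ∧ g ⇒ᵇ c) ⇒ᵇ g ⇒ᵇ l ⇒ᵇ c) refl
        (evalB v b ℓ) (evalB v b γ) (evalB v b χ)
      byCases : ⊢ ((θ ⇒ χ) ∧' (¬' θ ⇒ χ) ⇒ χ)
      byCases = taut λ v b → byTruthTable 2 (λ t c → (t ⇒ᵇ c) ∧ (not t ⇒ᵇ c) ⇒ᵇ c) refl
        (evalB v b θ) (evalB v b χ)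

  open Exhaustion ⊢_ (λ p q → mp (⇒-∧ (⇒-const p) (⇒-const q)) ⊤-intro) mp
    renaming (by-characteristic to ⊢-by-characteristic) public

  module _ (X : Form n) (G : Pattern n) where
    open Exhaustion (λ ψ → ⊢ (X ⇒ [ G ] ψ)) (□-∧ G) (λ p h → ⇒-trans h (□-mono G p))
      renaming (by-characteristic to □-by-characteristic) public

-- The canonical model

module Canonical {n : ℕ} (Φ : List (Form n)) (closed : SubformulaClosed Φ)
                 (□⊥∈Φ : ∀ G → [ G ] ⊥' ∈ Φ) where

  Atom : Set
  Atom = Vec Bool (length Φ)

  val : Atom → Form n → Bool
  val = valueIn Φ

  cf : Atom → Form n
  cf = characteristic Φ

  Refuted : Atom → Set
  Refuted a = ⊢ (¬' cf a)

  cf⇒ : ∀ a {ψ} → ψ ∈ Φ → val a ψ ≡ true → ⊢ (cf a ⇒ ψ)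
  cf⇒ a {ψ} m e = subst (λ x → ⊢ (cf a ⇒ literal ψ x)) e (characteristic⇒literal Φ a m)

  cf⇒¬ : ∀ a {ψ} → ψ ∈ Φ → val a ψ ≡ false → ⊢ (cf a ⇒ ¬' ψ)
  cf⇒¬ a {ψ} m e = subst (λ x → ⊢ (cf a ⇒ literal ψ x)) e (characteristic⇒literal Φ a m)

  CoherentAt : Atom → Form n → Set
  CoherentAt a (¬' χ)   = val a (¬' χ) ≡ not (val a χ)
  CoherentAt a (χ ∧' ψ) = val a (χ ∧' ψ) ≡ val a χ ∧ val a ψ
  CoherentAt a _        = ⊤

  Coherent : Atom → Set
  Coherent a = ∀ {ψ} → ψ ∈ Φ → CoherentAt a ψ

  coherent-or-refuted : ∀ a → Coherent a ⊎ Refuted a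
  coherent-or-refuted a = ∀∈-or Φ at
    where
    at : ∀ {ψ} → ψ ∈ Φ → CoherentAt a ψ ⊎ Refuted a
    at {var _}   _ = inj₁ tt
    at {[ _ ] _} _ = inj₁ tt
    at {¬' χ}    m with val a (¬' χ) Bool.≟ not (val a χ)
    ... | yes e  = inj₁ e
    ... | no ¬e  = inj₂ (refute-by-eval Φ a λ v b h →
      let eval = characteristic-eval v b Φ a h in
      ¬e (trans (sym (eval m)) (cong not (eval (closed m ≺¬)))))
    at {χ ∧' ψ}  m with val a (χ ∧' ψ) Bool.≟ val a χ ∧ val a ψ
    ... | yes e  = inj₁ e
    ... | no ¬e  = inj₂ (refute-by-eval Φ a λ v b h →
      let eval = characteristic-eval v b Φ a h in
      ¬e (trans (sym (eval m)) (cong₂ _∧_ (eval (closed m ≺∧ˡ)) (eval (closed m ≺∧ʳ)))))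

  val-⊥ : ∀ {a} → Coherent a → val a ⊥' ≡ false
  val-⊥ {a} coherent = begin
    val a ⊥'                            ≡⟨ coherent ⊥∈Φ ⟩
    val a (var 0) ∧ val a (¬' var 0)    ≡⟨ cong (val a (var 0) ∧_) (coherent (closed ⊥∈Φ ≺∧ʳ)) ⟩
    val a (var 0) ∧ not (val a (var 0)) ≡⟨ ∧-inverseʳ (val a (var 0)) ⟩
    false                               ∎
    where
    open ≡-Reasoning
    ⊥∈Φ : ⊥' ∈ Φ
    ⊥∈Φ = closed (□⊥∈Φ emptyᴾ) ≺□

  Agree : Atom → Atom → Pattern n → Form n → Set
  Agree a b K χ = val a ([ K ] χ) ≡ val b ([ K ] χ)
                × (val a ([ K ] χ) ≡ true → val a χ ≡ true × val b χ ≡ true)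

  -- Quantifying over all K ≼ G, not just K = G, makes the relation antitone in G, as K3 and K4
  -- require; □-refine keeps it sound.
  _∼⟨_⟩_ : Atom → Pattern n → Atom → Set
  a ∼⟨ G ⟩ b = ∀ {K χ} → [ K ] χ ∈ Φ → K ≼ G → Agree a b K χ

  module _ {G : Pattern n} where

    ∼-sym : ∀ {a b} → a ∼⟨ G ⟩ b → b ∼⟨ G ⟩ a
    ∼-sym a∼b m K≼G with e , both ← a∼b m K≼G = sym e , λ t → Product.swap (both (trans e t))

    ∼-trans : ∀ {a b c} → a ∼⟨ G ⟩ b → b ∼⟨ G ⟩ c → a ∼⟨ G ⟩ c
    ∼-trans a∼b b∼c m K≼G with e₁ , both₁ ← a∼b m K≼G | e₂ , both₂ ← b∼c m K≼G =
      trans e₁ e₂ , λ t → proj₁ (both₁ t) , proj₂ (both₂ (trans (sym e₁) t))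

    ∼-antitone : ∀ {G′ a b} → G′ ≼ G → a ∼⟨ G ⟩ b → a ∼⟨ G′ ⟩ b
    ∼-antitone G′≼G a∼b m K≼G′ = a∼b m (≼-trans K≼G′ G′≼G)

  separate : ∀ {a b K G θ} → K ≼ G → ⊢ (cf a ⇒ [ K ] θ) → ⊢ (cf b ⇒ ¬' θ) →
             ⊢ (cf a ⇒ [ G ] ¬' cf b)
  separate {G = G} {θ} K≼G p q = ⇒-trans p (⇒-trans (□-refine K≼G θ) (□-mono G (contraposition¬ q)))

  agree-or-separated : ∀ G a b {K χ} → [ K ] χ ∈ Φ →
                       (K ≼ G → Agree a b K χ) ⊎ ⊢ (cf a ⇒ [ G ] ¬' cf b)
  agree-or-separated G a b {K} {χ} m = dec-→-⊎ (K ≼? G) at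
    where
    mχ : χ ∈ Φ
    mχ = closed m ≺□
    at : K ≼ G → Agree a b K χ ⊎ ⊢ (cf a ⇒ [ G ] ¬' cf b)
    at K≼G with val a ([ K ] χ) in ea | val b ([ K ] χ) in eb
    ... | false | false = inj₁ (refl , λ ())
    ... | true  | false = inj₂ (separate K≼G (⇒-trans (cf⇒ a m ea) (ax4 K χ)) (cf⇒¬ b m eb))
    ... | false | true  = inj₂ (separate K≼G (⇒-trans (cf⇒¬ a m ea) (axiom5 K χ))
                                               (⇒-trans (cf⇒ b m eb) ¬¬-intro))
    ... | true  | true with val a χ in eaχ | val b χ in ebχ
    ...   | true  | true  = inj₁ (refl , λ _ → refl , refl)
    ...   | false | _     = inj₂ (separate K≼G (□-T⊥ (cf⇒ a m ea) (cf⇒¬ a mχ eaχ)) (⇒-const ⊤-intro))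
    ...   | true  | false = inj₂ (separate K≼G (cf⇒ a m ea) (cf⇒¬ b mχ ebχ))

  ∼-or-separated : ∀ G a b → a ∼⟨ G ⟩ b ⊎ ⊢ (cf a ⇒ [ G ] ¬' cf b)
  ∼-or-separated G a b = ∀□∈-or Φ (agree-or-separated G a b)

  AliveIn : Atom → Pattern n → Set
  AliveIn a G = val a ([ G ] ⊥') ≡ false

  record Good (a : Atom) : Set where
    constructor good
    field
      coherent        : Coherent a
      alive⇒reflexive : ∀ G → AliveIn a G → a ∼⟨ G ⟩ a
      alive-∪         : ∀ G H → AliveIn a G → AliveIn a H → AliveIn a (G ∪ᴾ H)
      alive-clo       : ∀ G A B → A ∈ᴾ G → B ∈ᴾ G → AliveIn a G → AliveIn a (singleᴾ (A ∪ˢ B))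
      some-alive      : ∃ (AliveIn a)

  module _ (a : Atom) where

    alive? : ∀ G → Dec (AliveIn a G)
    alive? G = val a ([ G ] ⊥') Bool.≟ false

    cf⇒alive : ∀ {G} → AliveIn a G → ⊢ (cf a ⇒ alive G)
    cf⇒alive {G} = cf⇒¬ a (□⊥∈Φ G)

    alive-or-refuted : ∀ G → ⊢ (cf a ⇒ alive G) → AliveIn a G ⊎ Refuted a
    alive-or-refuted G p =
      Sum.map₂ (λ ¬alive → ⇒-absurd (cf⇒ a (□⊥∈Φ G) (¬-not ¬alive)) p) (Dec.toSum (alive? G))

    reflexive-or-refuted : (∀ G → AliveIn a G → a ∼⟨ G ⟩ a) ⊎ Refuted a
    reflexive-or-refuted = Patterns.∀-or λ G → dec-→-⊎ (alive? G) λ aG →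
      Sum.map₂ (λ sep → ⇒-absurd ⇒-refl (□-T (cf⇒alive aG) sep)) (∼-or-separated G a a)

    union-or-refuted : (∀ G H → AliveIn a G → AliveIn a H → AliveIn a (G ∪ᴾ H)) ⊎ Refuted a
    union-or-refuted = Patterns.∀-or λ G → Patterns.∀-or λ H →
      dec-→-⊎ (alive? G) λ aG → dec-→-⊎ (alive? H) λ aH →
      alive-or-refuted (G ∪ᴾ H) (⇒-trans (⇒-∧ (cf⇒alive aG) (cf⇒alive aH)) (union G H))

    clo-or-refuted : (∀ G A B → A ∈ᴾ G → B ∈ᴾ G → AliveIn a G → AliveIn a (singleᴾ (A ∪ˢ B)))
                     ⊎ Refuted a
    clo-or-refuted = Patterns.∀-or λ G → Subsets.∀-or λ A → Subsets.∀-or λ B →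
      dec-→-⊎ (A ∈ᴾ? G) λ A∈G → dec-→-⊎ (B ∈ᴾ? G) λ B∈G → dec-→-⊎ (alive? G) λ aG →
      alive-or-refuted (singleᴾ (A ∪ˢ B)) (⇒-trans (cf⇒alive aG) (clo G A B A∈G B∈G))

    some-alive-or-refuted : ∃ (AliveIn a) ⊎ Refuted a
    some-alive-or-refuted = Sum.map₂ all-dead⇒refuted (Dec.toSum (Patterns.∃? alive?))
      where
      all-dead⇒refuted : ¬ ∃ (AliveIn a) → Refuted a
      all-dead⇒refuted none = ⇒-absurd (⇒-const axNE) (⇒-¬⋁ alive (allPatterns n) λ G →
        ⇒-trans (cf⇒ a (□⊥∈Φ G) (¬-not (none ∘ (G ,_)))) ¬¬-intro)

    good-or-refuted : Good a ⊎ Refuted a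
    good-or-refuted = good <$> coherent-or-refuted a ⊛ reflexive-or-refuted ⊛ union-or-refuted
                           ⊛ clo-or-refuted ⊛ some-alive-or-refuted
      where open RawApplicative (Sumᵣ.applicative 0ℓ (Refuted a))

  Witnessed : List Atom → Atom → Set
  Witnessed S a = ∀ {G χ} → [ G ] χ ∈ Φ → val a ([ G ] χ) ≡ false →
                  ∃ λ b → b ∈ S × a ∼⟨ G ⟩ b × val b χ ≡ false

  witnessed-or-refuted : ∀ S → Covers Refuted S → ∀ a → Witnessed S a ⊎ Refuted a
  witnessed-or-refuted S cover a = ∀□∈-or Φ λ {G} {χ} m →
    dec-→-⊎ (val a ([ G ] χ) Bool.≟ false) (witness-or-refuted G χ m)
    where
    excluded-or-witness : ∀ G χ → χ ∈ Φ → ∀ b →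
                          ⊢ (cf a ⇒ [ G ] (cf b ⇒ χ)) ⊎ (a ∼⟨ G ⟩ b × val b χ ≡ false)
    excluded-or-witness G χ mχ b with ∼-or-separated G a b
    ... | inj₂ sep = inj₁ (⇒-trans sep (□-mono G explosion))
    ... | inj₁ a∼b with val b χ Bool.≟ false
    ...   | yes e  = inj₂ (a∼b , e)
    ...   | no ¬e  = inj₁ (⇒-const (nec G (cf⇒ b mχ (¬-not ¬e))))

    witness-or-refuted : ∀ G χ → [ G ] χ ∈ Φ → val a ([ G ] χ) ≡ false →
                         (∃ λ b → b ∈ S × a ∼⟨ G ⟩ b × val b χ ≡ false) ⊎ Refuted a
    witness-or-refuted G χ m e with All.decide (excluded-or-witness G χ (closed m ≺□)) S
    ... | inj₂ witness  = inj₁ (find witness)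
    ... | inj₁ excluded = inj₂ (⇒-absurd
      (□-by-characteristic (cf a) G Φ λ b →
        [ All.lookup excluded , (λ r → ⇒-const (nec G (¬-⇒ r))) ]′ (cover b))
      (cf⇒¬ a m e))

  Ok : List Atom → Atom → Set
  Ok S a = Good a × Witnessed S a

  ok-or-refuted : ∀ S → Covers Refuted S → ∀ a → Ok S a ⊎ Refuted a
  ok-or-refuted S cover a with good-or-refuted a
  ... | inj₂ r = inj₂ r
  ... | inj₁ g = Sum.map₁ (λ (w : Witnessed S a) → g , w) (witnessed-or-refuted S cover a)

  open Elimination Refuted Ok ok-or-refuted

  stable : ∃ Stable
  stable = eliminate (vectors (length Φ)) (inj₁ ∘ vectors-complete)

  Survivors : List Atom
  Survivors = proj₁ stable

  covers : Covers Refuted Survivors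
  covers = proj₁ (proj₂ stable)

  World : Set
  World = ∃ (_∈ Survivors)

  good* : (w : World) → Good (proj₁ w)
  good* (a , a∈S) = proj₁ (proj₂ (proj₂ stable) a∈S)

  witnessed* : (w : World) → Witnessed Survivors (proj₁ w)
  witnessed* (a , a∈S) = proj₂ (proj₂ (proj₂ stable) a∈S)

  model : PreModel n
  model = record
    { W      = World
    ; _∼[_]_ = λ w G v → proj₁ w ∼⟨ G ⟩ proj₁ v
    ; sym∼   = λ _ → ∼-sym
    ; trans∼ = λ _ → ∼-trans
    ; V      = λ w p → val (proj₁ w) (var p)
    }

  truth : ∀ {ψ} → ψ ∈ Φ → ∀ w → Reflects (model ∣ w ⊩ ψ) (val (proj₁ w) ψ)
  truth {var p}   m w = T-reflects _
  truth {¬' χ}    m w = subst (Reflects _) (sym (Good.coherent (good* w) m))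
    (¬-reflects (truth (closed m ≺¬) w))
  truth {χ ∧' ψ}  m w = subst (Reflects _) (sym (Good.coherent (good* w) m))
    (truth (closed m ≺∧ˡ) w ×-reflects truth (closed m ≺∧ʳ) w)
  truth {[ G ] χ} m w with val (proj₁ w) ([ G ] χ) in e
  ... | true  = ofʸ λ v w∼v → reflects⇒ (truth (closed m ≺□) v) (proj₂ (proj₂ (w∼v m ≼-refl) e))
  ... | false = ofⁿ λ h → let b , b∈S , w∼b , e′ = witnessed* w m e in
    reflects¬ (truth (closed m ≺□) (b , b∈S)) e′ (h (b , b∈S) w∼b)

  related⇒alive : ∀ {a G} → Good a → a ∼⟨ G ⟩ a → AliveIn a G
  related⇒alive {a} {G} g a∼a = ¬-not λ dead →
    let ⊥-true = proj₁ (proj₂ (a∼a (□⊥∈Φ G) ≼-refl) dead)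
    in contradiction (trans (sym (val-⊥ (Good.coherent g))) ⊥-true) λ ()

  alive-in : ∀ w {G} → Alive model G w → AliveIn (proj₁ w) G
  alive-in w = related⇒alive (good* w)

  κ-model : IsκModel model
  κ-model = record
    { K1 = λ G H w p q → let open Good (good* w) in
             alive⇒reflexive _ (alive-∪ G H (alive-in w p) (alive-in w q))
    ; K2 = λ G A B A∈G B∈G w p → let open Good (good* w) in
             alive⇒reflexive _ (alive-clo G A B A∈G B∈G (alive-in w p))
    ; K3 = λ G H G⊆H _ _ → ∼-antitone (⊆ᴾ⇒≼ G⊆H)
    ; K4 = λ G A B A∈G B⊆A _ _ _ → ∼-antitone (∪-single-≼ A∈G B⊆A)
    ; NE = λ w → let open Good (good* w); G , aG = some-alive in G , alive⇒reflexive G aG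
    }

  completeness : ∀ {φ} → φ ∈ Φ → κ-valid φ → ⊢ φ
  completeness {φ} φ∈Φ valid = ⊢-by-characteristic Φ λ a → [ survivor a , ¬-⇒ ]′ (covers a)
    where
    survivor : ∀ a → a ∈ Survivors → ⊢ (cf a ⇒ φ)
    survivor a a∈S = cf⇒ a φ∈Φ (reflects⇐ (truth φ∈Φ (a , a∈S)) (valid model κ-model (a , a∈S)))

theorem5p17 : ∀ (n : ℕ) (φ : Form n) → κ-valid φ → ⊢ φ
theorem5p17 n φ =
  Canonical.completeness Φ (subformulas⋆-closed Γ) □⊥∈Φ (⊆-subformulas⋆ Γ (here refl))
  where
  Γ Φ : List (Form n)
  Γ = φ ∷ map (λ G → [ G ] ⊥') (allPatterns n)
  Φ = subformulas⋆ Γ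
  □⊥∈Φ : ∀ G → [ G ] ⊥' ∈ Φ
  □⊥∈Φ G = ⊆-subformulas⋆ Γ (there (∈-map⁺ _ (allPatterns-complete G)))
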